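{- Let $\mathcal{A}=(A,\leq,\otimes,e,\to)$ be a strong algebra whose multiplication has a left residual $\Rightarrow$ (i.e. $a\otimes b\leq c$ iff $b\leq a\Rightarrow c$ for all $a,b,c\in A$) and which internalizes its closed monoidal structure, i.e. for all $a,b,c\in A$: \[ a\to b\leq (c\otimes a)\to(c\otimes b)\quad\text{and}\quad (a\otimes b)\to c\leq b\to(a\Rightarrow c). \] Then there exist a non-commutative spacetime $\mathcal{S}=(\mathscr{X},\nabla)$ and a strong algebra embedding $i:\mathcal{A}\to(\mathscr{X},\leq,\otimes,e,\to_{\mathcal{S}})$.
   Context: A monoidal poset is a poset with a monoid structure $(\otimes,e)$ whose multiplication is order preserving in each argument. A strong algebra is a monoidal poset with a map $\to:A^{op}\times A\to A$ (order reversing in the first argument, order preserving in the second) such that $e\leq a\to a$ and $(a\to b)\otimes(b\to c)\leq a\to c$. A quantale is a monoidal poset with all joins whose multiplication distributes over arbitrary joins on both sides. A non-commutative spacetime is a pair $(\mathscr{X},\nabla)$ with $\mathscr{X}$ a quantale and $\nabla$ a join preserving, oplax monoidal ($\nabla e\leq e$, $\nabla(a\otimes b)\leq\nabla a\otimes\nabla b$) self-map; its implication $\to_{\mathcal{S}}$ is defined by $a\otimes\nabla b\leq c$ iff $b\leq a\to_{\mathcal{S}}c$ (this makes $(\mathscr{X},\leq,\otimes,e,\to_{\mathcal{S}})$ a strong algebra). A strong algebra embedding is a strict monoidal map ($i(e)=e$, $i(a\otimes b)=i(a)\otimes i(b)$) which preserves $\to$ and is an order embedding. -}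

module Defs where

open import Level using (Level; _⊔_) renaming (suc to lsuc)
open import Relation.Binary.Bundles using (Poset)
open import Function.Bundles using (_⇔_)
open import Data.Product using (Σ; _×_)

record MonoidalPoset (c ℓ₁ ℓ₂ : Level) : Set (lsuc (c ⊔ ℓ₁ ⊔ ℓ₂)) where
  field
    poset : Poset c ℓ₁ ℓ₂
  open Poset poset public
  infixl 7 _⊗_
  field
    _⊗_ : Carrier → Carrier → Carrier
    e   : Carrier
    ⊗-assoc     : ∀ a b c → ((a ⊗ b) ⊗ c) ≈ (a ⊗ (b ⊗ c))
    ⊗-identityˡ : ∀ a → (e ⊗ a) ≈ a
    ⊗-identityʳ : ∀ a → (a ⊗ e) ≈ a
    ⊗-monoˡ     : ∀ {a a′} b → a ≤ a′ → (a ⊗ b) ≤ (a′ ⊗ b)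
    ⊗-monoʳ     : ∀ a {b b′} → b ≤ b′ → (a ⊗ b) ≤ (a ⊗ b′)

record StrongAlgebra (c ℓ₁ ℓ₂ : Level) : Set (lsuc (c ⊔ ℓ₁ ⊔ ℓ₂)) where
  field
    monoidalPoset : MonoidalPoset c ℓ₁ ℓ₂
  open MonoidalPoset monoidalPoset public
  infixr 5 _⟶_
  field
    _⟶_      : Carrier → Carrier → Carrier
    ⟶-antitoneˡ : ∀ {a a′} b → a ≤ a′ → (a′ ⟶ b) ≤ (a ⟶ b)
    ⟶-monoʳ     : ∀ a {b b′} → b ≤ b′ → (a ⟶ b) ≤ (a ⟶ b′)
    ⟶-refl      : ∀ a → e ≤ (a ⟶ a)
    ⟶-trans     : ∀ a b c → ((a ⟶ b) ⊗ (b ⟶ c)) ≤ (a ⟶ c)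

record Quantale (c ℓ₁ ℓ₂ j : Level) : Set (lsuc (c ⊔ ℓ₁ ⊔ ℓ₂ ⊔ j)) where
  field
    monoidalPoset : MonoidalPoset c ℓ₁ ℓ₂
  open MonoidalPoset monoidalPoset public
  field
    ⋁        : {I : Set j} → (I → Carrier) → Carrier
    ⋁-upper  : {I : Set j} (f : I → Carrier) (i : I) → f i ≤ ⋁ f
    ⋁-least  : {I : Set j} (f : I → Carrier) (u : Carrier) →
               (∀ i → f i ≤ u) → ⋁ f ≤ u
    ⊗-distribˡ-⋁ : ∀ a {I : Set j} (f : I → Carrier) →
                   (a ⊗ ⋁ f) ≈ ⋁ (λ i → a ⊗ f i)
    ⊗-distribʳ-⋁ : ∀ a {I : Set j} (f : I → Carrier) →
                   (⋁ f ⊗ a) ≈ ⋁ (λ i → f i ⊗ a)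

record Spacetime (c ℓ₁ ℓ₂ j : Level) : Set (lsuc (c ⊔ ℓ₁ ⊔ ℓ₂ ⊔ j)) where
  field
    quantale : Quantale c ℓ₁ ℓ₂ j
  open Quantale quantale public
  field
    ∇          : Carrier → Carrier
    ∇-⋁        : {I : Set j} (f : I → Carrier) → ∇ (⋁ f) ≈ ⋁ (λ i → ∇ (f i))
    ∇-e        : ∇ e ≤ e
    ∇-⊗        : ∀ a b → ∇ (a ⊗ b) ≤ (∇ a ⊗ ∇ b)

-- r is (a representative of) the spacetime implication a →_S c, i.e.
-- for all b:  a ⊗ ∇ b ≤ c  iff  b ≤ r.
IsImplicationₛ : ∀ {c ℓ₁ ℓ₂ j} (S : Spacetime c ℓ₁ ℓ₂ j) →
                 (x z r : Spacetime.Carrier S) → Set (c ⊔ ℓ₂)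
IsImplicationₛ S x z r =
  ∀ y → (x ⊗ ∇ y ≤ z) ⇔ (y ≤ r)
  where open Spacetime S

record IsStrongEmbedding {a ℓ₁ ℓ₂ c k₁ k₂ j}
         (A : StrongAlgebra a ℓ₁ ℓ₂) (S : Spacetime c k₁ k₂ j)
         (i : StrongAlgebra.Carrier A → Spacetime.Carrier S)
         : Set (a ⊔ ℓ₂ ⊔ c ⊔ k₁ ⊔ k₂) where
  private
    module A = StrongAlgebra A
    module S = Spacetime S
  field
    i-e       : i A.e S.≈ S.e
    i-⊗       : ∀ x y → i (x A.⊗ y) S.≈ (i x S.⊗ i y)
    i-⟶       : ∀ x y → IsImplicationₛ S (i x) (i y) (i (x A.⟶ y))
    i-order   : ∀ x y → (i x S.≤ i y) ⇔ (x A.≤ y)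

IsLeftResidual : ∀ {a ℓ₁ ℓ₂} (A : StrongAlgebra a ℓ₁ ℓ₂) →
                 (StrongAlgebra.Carrier A → StrongAlgebra.Carrier A →
                  StrongAlgebra.Carrier A) → Set (a ⊔ ℓ₂)
IsLeftResidual A _⇒_ = ∀ x y z → (x ⊗ y ≤ z) ⇔ (y ≤ (x ⇒ z))
  where open StrongAlgebra A

Internalizes : ∀ {a ℓ₁ ℓ₂} (A : StrongAlgebra a ℓ₁ ℓ₂) →
               (StrongAlgebra.Carrier A → StrongAlgebra.Carrier A →
                StrongAlgebra.Carrier A) → Set (a ⊔ ℓ₂)
Internalizes A _⇒_ =
  (∀ x y z → (x ⟶ y) ≤ ((z ⊗ x) ⟶ (z ⊗ y))) ×
  (∀ x y z → ((x ⊗ y) ⟶ z) ≤ (y ⟶ (x ⇒ z)))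
  where open StrongAlgebra A

-- Module Downsets: for a preordered monoid M with a monotone oplax monoidal d,
-- the downsets of M form a spacetime (unions, down-closed products ⊛, and
-- ∇ Z = down-closure of d[Z]); ↓ k is the implication ↓ m →ₛ ↓ n whenever
-- m · d s ≼ n ⇔ s ≼ k for all s.  So a monoidal order embedding j : A → M
-- with this property for k = j (x ⟶ y) gives the embedding x ↦ ↓ j x.
--
-- Module TermModel: M consists of terms pt x, s · t, ◇ t denoting upsets of A
-- (↑x, pointwise products, preimages under □ = e ⟶ _), preordered by reverse
-- inclusion, with d = ◇.  The hypotheses on A enter only through two facts:
-- □ is lax monoidal, and x ⟶ y ≈ □ (x ⇒ y), which gives the residuation
-- property of pt.

module Submission where

open import Defs
open import Level using (Level; _⊔_; Lift; lift; lower) renaming (suc to lsuc)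
open import Data.Product using (Σ; _×_; _,_; proj₁; proj₂)
open import Function.Bundles using (_⇔_; mk⇔; Equivalence)
open import Function.Construct.Composition using (_⇔-∘_)
open import Function.Construct.Symmetry using (⇔-sym)
open import Relation.Binary.Bundles using (Poset)
import Relation.Binary.Reasoning.PartialOrder as PosetReasoning

record OplaxPreorderedMonoid (ℓ : Level) : Set (lsuc ℓ) where
  infix  4 _≼_ _≋_
  infixl 7 _·_
  field
    Carrier    : Set ℓ
    _≼_        : Carrier → Carrier → Set ℓ
    ≼-refl     : ∀ {s} → s ≼ s
    ≼-trans    : ∀ {s t u} → s ≼ t → t ≼ u → s ≼ u
    _·_        : Carrier → Carrier → Carrier
    ε          : Carrier
    ·-mono     : ∀ {s s′ t t′} → s ≼ s′ → t ≼ t′ → s · t ≼ s′ · t′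
    ·-assoc⃗    : ∀ s t u → (s · t) · u ≼ s · (t · u)
    ·-assoc⃖    : ∀ s t u → s · (t · u) ≼ (s · t) · u
    ·-identityˡ⃗ : ∀ s → ε · s ≼ s
    ·-identityˡ⃖ : ∀ s → s ≼ ε · s
    ·-identityʳ⃗ : ∀ s → s · ε ≼ s
    ·-identityʳ⃖ : ∀ s → s ≼ s · ε
    d          : Carrier → Carrier
    d-mono     : ∀ {s t} → s ≼ t → d s ≼ d t
    d-ε        : d ε ≼ ε
    d-·        : ∀ s t → d (s · t) ≼ d s · d t

  _≋_ : Carrier → Carrier → Set ℓ
  s ≋ t = (s ≼ t) × (t ≼ s)

module Downsets {ℓ} (M : OplaxPreorderedMonoid ℓ) where
  open OplaxPreorderedMonoid M

  record Downset : Set (lsuc ℓ) where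
    constructor downset
    field
      _∈_    : Carrier → Set ℓ
      closed : ∀ {s t} → s ≼ t → _∈_ t → _∈_ s
  open Downset

  infix 4 _⊑_ _≃_
  _⊑_ : Downset → Downset → Set ℓ
  Z ⊑ W = ∀ {t} → (Z ∈ t) → (W ∈ t)

  _≃_ : Downset → Downset → Set ℓ
  Z ≃ W = (Z ⊑ W) × (W ⊑ Z)

  ↓_ : Carrier → Downset
  ↓ n = downset (λ t → t ≼ n) ≼-trans

  infixl 7 _⊛_
  _⊛_ : Downset → Downset → Downset
  Z ⊛ W = downset
    (λ t → Σ Carrier λ s → Σ Carrier λ s′ → (Z ∈ s) × (W ∈ s′) × (t ≼ s · s′))
    (λ { le (s , s′ , p , q , r) → s , s′ , p , q , ≼-trans le r })

  ⋃ : {I : Set ℓ} → (I → Downset) → Downset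
  ⋃ {I} f = downset (λ t → Σ I λ i → f i ∈ t)
    (λ { le (i , p) → i , closed (f i) le p })

  ∇ : Downset → Downset
  ∇ Z = downset (λ t → Σ Carrier λ s → (Z ∈ s) × (t ≼ d s))
    (λ { le (s , p , r) → s , p , ≼-trans le r })

  ⊛-least : ∀ Z W V → (∀ {s s′} → Z ∈ s → W ∈ s′ → V ∈ (s · s′)) → Z ⊛ W ⊑ V
  ⊛-least Z W V h (s , s′ , p , q , r) = closed V r (h p q)

  ⊛-pair : ∀ {Z W s s′} → Z ∈ s → W ∈ s′ → (Z ⊛ W) ∈ (s · s′)
  ⊛-pair p q = _ , _ , p , q , ≼-refl

  ⊛-assoc⃗ : ∀ Z W V → (Z ⊛ W) ⊛ V ⊑ Z ⊛ (W ⊛ V)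
  ⊛-assoc⃗ Z W V = ⊛-least (Z ⊛ W) V (Z ⊛ (W ⊛ V)) λ { (s , s′ , p , q , r) p″ →
    s , _ , p , ⊛-pair {W} {V} q p″ , ≼-trans (·-mono r ≼-refl) (·-assoc⃗ s s′ _) }

  ⊛-assoc⃖ : ∀ Z W V → Z ⊛ (W ⊛ V) ⊑ (Z ⊛ W) ⊛ V
  ⊛-assoc⃖ Z W V = ⊛-least Z (W ⊛ V) ((Z ⊛ W) ⊛ V) λ { p (s′ , s″ , q , p″ , r) →
    _ , s″ , ⊛-pair {Z} {W} p q , p″ , ≼-trans (·-mono ≼-refl r) (·-assoc⃖ _ s′ s″) }

  ⊛-identityˡ : ∀ Z → ↓ ε ⊛ Z ≃ Z
  ⊛-identityˡ Z =
    ⊛-least (↓ ε) Z Z (λ s≼ε p →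
      closed Z (≼-trans (·-mono s≼ε ≼-refl) (·-identityˡ⃗ _)) p)
    , λ p → ε , _ , ≼-refl , p , ·-identityˡ⃖ _

  ⊛-identityʳ : ∀ Z → Z ⊛ ↓ ε ≃ Z
  ⊛-identityʳ Z =
    ⊛-least Z (↓ ε) Z (λ p s≼ε →
      closed Z (≼-trans (·-mono ≼-refl s≼ε) (·-identityʳ⃗ _)) p)
    , λ p → _ , ε , p , ≼-refl , ·-identityʳ⃖ _

  poset : Poset (lsuc ℓ) ℓ ℓ
  poset = record
    { Carrier = Downset ; _≈_ = _≃_ ; _≤_ = _⊑_
    ; isPartialOrder = record
      { isPreorder = record
        { isEquivalence = record
          { refl  = (λ p → p) , (λ p → p)
          ; sym   = λ { (f , g) → g , f }
          ; trans = λ { (f , g) (f′ , g′) → (λ p → f′ (f p)) , (λ p → g (g′ p)) } }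
        ; reflexive = proj₁
        ; trans     = λ f g p → g (f p) }
      ; antisym = _,_ } }

  monoidalPoset : MonoidalPoset (lsuc ℓ) ℓ ℓ
  monoidalPoset = record
    { poset       = poset
    ; _⊗_         = _⊛_
    ; e           = ↓ ε
    ; ⊗-assoc     = λ Z W V → ⊛-assoc⃗ Z W V , ⊛-assoc⃖ Z W V
    ; ⊗-identityˡ = ⊛-identityˡ
    ; ⊗-identityʳ = ⊛-identityʳ
    ; ⊗-monoˡ     = λ {Z} {Z′} W Z⊑Z′ →
        ⊛-least Z W (Z′ ⊛ W) λ p q → ⊛-pair {Z′} {W} (Z⊑Z′ p) q
    ; ⊗-monoʳ     = λ Z {W} {W′} W⊑W′ →
        ⊛-least Z W (Z ⊛ W′) λ p q → ⊛-pair {Z} {W′} p (W⊑W′ q)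
    }

  quantale : Quantale (lsuc ℓ) ℓ ℓ ℓ
  quantale = record
    { monoidalPoset = monoidalPoset
    ; ⋁             = ⋃
    ; ⋁-upper       = λ f i p → i , p
    ; ⋁-least       = λ f V h → λ { (i , p) → h i p }
    ; ⊗-distribˡ-⋁  = λ Z f →
        (λ { (s , s′ , p , (i , q) , r) → i , s , s′ , p , q , r })
      , (λ { (i , s , s′ , p , q , r) → s , s′ , p , (i , q) , r })
    ; ⊗-distribʳ-⋁  = λ Z f →
        (λ { (s , s′ , (i , p) , q , r) → i , s , s′ , p , q , r })
      , (λ { (i , s , s′ , p , q , r) → s , s′ , (i , p) , q , r })
    }

  spacetime : Spacetime (lsuc ℓ) ℓ ℓ ℓ
  spacetime = record
    { quantale = quantale
    ; ∇        = ∇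
    ; ∇-⋁      = λ f →
        (λ { (s , (i , p) , r) → i , s , p , r })
      , (λ { (i , s , p , r) → s , (i , p) , r })
    ; ∇-e      = λ { (s , s≼ε , t≼ds) → ≼-trans t≼ds (≼-trans (d-mono s≼ε) d-ε) }
    ; ∇-⊗      = λ Z W → λ { (r , (s , s′ , p , q , r≼ss′) , t≼dr) →
        d s , d s′ , (s , p , ≼-refl) , (s′ , q , ≼-refl)
        , ≼-trans t≼dr (≼-trans (d-mono r≼ss′) (d-· s s′)) }
    }

  ↓-order : ∀ {m n} → (↓ m ⊑ ↓ n) ⇔ (m ≼ n)
  ↓-order = mk⇔ (λ h → h ≼-refl) (λ m≼n {_} t≼m → ≼-trans t≼m m≼n)

  ↓-cong : ∀ {m n} → m ≋ n → ↓ m ≃ ↓ n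
  ↓-cong (m≼n , n≼m) = Equivalence.from ↓-order m≼n , Equivalence.from ↓-order n≼m

  ↓-· : ∀ {k} m n → k ≋ m · n → ↓ k ≃ ↓ m ⊛ ↓ n
  ↓-· {k} m n (k≼mn , mn≼k) =
      (λ t≼k → m , n , ≼-refl , ≼-refl , ≼-trans t≼k k≼mn)
    , ⊛-least (↓ m) (↓ n) (↓ k) (λ s≼m s′≼n → ≼-trans (·-mono s≼m s′≼n) mn≼k)

  ↓-implication : ∀ {m n k} → (∀ s → (m · d s ≼ n) ⇔ (s ≼ k)) →
                  IsImplicationₛ spacetime (↓ m) (↓ n) (↓ k)
  ↓-implication {m} {n} {k} residual Z = mk⇔ below-k below-n
    where
    below-k : ↓ m ⊛ ∇ Z ⊑ ↓ n → Z ⊑ ↓ k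
    below-k h {s} p =
      Equivalence.to (residual s) (h (⊛-pair {↓ m} {∇ Z} ≼-refl (s , p , ≼-refl)))

    below-n : Z ⊑ ↓ k → ↓ m ⊛ ∇ Z ⊑ ↓ n
    below-n g = ⊛-least (↓ m) (∇ Z) (↓ n) λ { r≼m (s , p , r′≼ds) →
      ≼-trans (·-mono r≼m r′≼ds) (Equivalence.from (residual s) (g p)) }

  principal-embedding :
    ∀ {a ℓ₁ ℓ₂} (A : StrongAlgebra a ℓ₁ ℓ₂) (j : StrongAlgebra.Carrier A → Carrier) →
    let module A = StrongAlgebra A in
    j A.e ≋ ε →
    (∀ x y → j (x A.⊗ y) ≋ j x · j y) →
    (∀ x y → (j x ≼ j y) ⇔ (x A.≤ y)) →
    (∀ x y s → (j x · d s ≼ j y) ⇔ (s ≼ j (x A.⟶ y))) →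
    IsStrongEmbedding A spacetime (λ x → ↓ j x)
  principal-embedding A j j-e j-⊗ j-order j-⟶ = record
    { i-e     = ↓-cong j-e
    ; i-⊗     = λ x y → ↓-· (j x) (j y) (j-⊗ x y)
    ; i-⟶     = λ x y → ↓-implication (j-⟶ x y)
    ; i-order = λ x y → j-order x y ⇔-∘ ↓-order
    }
    where module A = StrongAlgebra A

module TermModel {a ℓ₁ ℓ₂} (A : StrongAlgebra a ℓ₁ ℓ₂)
  (_⇒_ : StrongAlgebra.Carrier A → StrongAlgebra.Carrier A → StrongAlgebra.Carrier A)
  (residual : IsLeftResidual A _⇒_) (internal : Internalizes A _⇒_) where

  open StrongAlgebra A
  open PosetReasoning poset

  L : Level
  L = a ⊔ ℓ₁ ⊔ ℓ₂

  strength : ∀ x y z → (x ⟶ y) ≤ ((z ⊗ x) ⟶ (z ⊗ y))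
  strength = proj₁ internal

  currying : ∀ x y z → ((x ⊗ y) ⟶ z) ≤ (y ⟶ (x ⇒ z))
  currying = proj₂ internal

  eval : ∀ x y → (x ⊗ (x ⇒ y)) ≤ y
  eval x y = Equivalence.from (residual x (x ⇒ y) y) refl

  □ : Carrier → Carrier
  □ c = e ⟶ c

  □-strength : ∀ u v → □ v ≤ (u ⟶ (u ⊗ v))
  □-strength u v = begin
    e ⟶ v               ≤⟨ strength e v u ⟩
    (u ⊗ e) ⟶ (u ⊗ v)   ≤⟨ ⟶-antitoneˡ (u ⊗ v) (reflexive (Eq.sym (⊗-identityʳ u))) ⟩
    u ⟶ (u ⊗ v)         ∎

  -- □ is lax monoidal; this makes ◇ oplax in the term model.
  □-⊗ : ∀ u v → (□ u ⊗ □ v) ≤ □ (u ⊗ v)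
  □-⊗ u v = begin
    (e ⟶ u) ⊗ □ v             ≤⟨ ⊗-monoʳ (e ⟶ u) (□-strength u v) ⟩
    (e ⟶ u) ⊗ (u ⟶ (u ⊗ v))   ≤⟨ ⟶-trans e u (u ⊗ v) ⟩
    e ⟶ (u ⊗ v)               ∎

  ⟶≤□⇒ : ∀ x y → (x ⟶ y) ≤ □ (x ⇒ y)
  ⟶≤□⇒ x y = begin
    x ⟶ y         ≤⟨ ⟶-antitoneˡ y (reflexive (⊗-identityʳ x)) ⟩
    (x ⊗ e) ⟶ y   ≤⟨ currying x e y ⟩
    e ⟶ (x ⇒ y)   ∎

  □⇒≤⟶ : ∀ x y → □ (x ⇒ y) ≤ (x ⟶ y)
  □⇒≤⟶ x y = begin
    □ (x ⇒ y)           ≤⟨ □-strength x (x ⇒ y) ⟩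
    x ⟶ (x ⊗ (x ⇒ y))   ≤⟨ ⟶-monoʳ x (eval x y) ⟩
    x ⟶ y               ∎

  -- Formal expressions built from points of A; the type lives in Set L so
  -- that downsets of terms are small enough for the statement's universes.
  infixl 7 _·_
  data Term : Set L where
    pt  : Carrier → Term
    _·_ : Term → Term → Term
    ◇   : Term → Term

  ⟦_⟧ : Term → Carrier → Set L
  ⟦ pt x ⟧  c = Lift L (x ≤ c)
  ⟦ t · s ⟧ c = Σ Carrier λ u → Σ Carrier λ v → ⟦ t ⟧ u × ⟦ s ⟧ v × Lift L ((u ⊗ v) ≤ c)
  ⟦ ◇ t ⟧   c = ⟦ t ⟧ (□ c)

  ⟦⟧-up : ∀ t {c c′} → c ≤ c′ → ⟦ t ⟧ c → ⟦ t ⟧ c′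
  ⟦⟧-up (pt x)  c≤c′ (lift x≤c) = lift (trans x≤c c≤c′)
  ⟦⟧-up (t · s) c≤c′ (u , v , p , q , lift uv≤c) = u , v , p , q , lift (trans uv≤c c≤c′)
  ⟦⟧-up (◇ t)   c≤c′ p = ⟦⟧-up t (⟶-monoʳ e c≤c′) p

  infix 4 _≼_
  _≼_ : Term → Term → Set L
  t ≼ s = ∀ {c} → ⟦ s ⟧ c → ⟦ t ⟧ c

  ·-mono : ∀ {s s′ t t′} → s ≼ s′ → t ≼ t′ → s · t ≼ s′ · t′
  ·-mono s≼s′ t≼t′ (u , v , p , q , r) = u , v , s≼s′ p , t≼t′ q , r

  ·-assoc⃗ : ∀ s t r → (s · t) · r ≼ s · (t · r)
  ·-assoc⃗ s t r (u₁ , w , p₁ , (u₂ , u₃ , p₂ , p₃ , lift u₂u₃≤w) , lift u₁w≤c) =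
    u₁ ⊗ u₂ , u₃ , (u₁ , u₂ , p₁ , p₂ , lift refl) , p₃ , lift (begin
      (u₁ ⊗ u₂) ⊗ u₃   ≈⟨ ⊗-assoc u₁ u₂ u₃ ⟩
      u₁ ⊗ (u₂ ⊗ u₃)   ≤⟨ ⊗-monoʳ u₁ u₂u₃≤w ⟩
      u₁ ⊗ w           ≤⟨ u₁w≤c ⟩
      _                ∎)

  ·-assoc⃖ : ∀ s t r → s · (t · r) ≼ (s · t) · r
  ·-assoc⃖ s t r (w , u₃ , (u₁ , u₂ , p₁ , p₂ , lift u₁u₂≤w) , p₃ , lift wu₃≤c) =
    u₁ , u₂ ⊗ u₃ , p₁ , (u₂ , u₃ , p₂ , p₃ , lift refl) , lift (begin
      u₁ ⊗ (u₂ ⊗ u₃)   ≈⟨ Eq.sym (⊗-assoc u₁ u₂ u₃) ⟩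
      (u₁ ⊗ u₂) ⊗ u₃   ≤⟨ ⊗-monoˡ u₃ u₁u₂≤w ⟩
      w ⊗ u₃           ≤⟨ wu₃≤c ⟩
      _                ∎)

  ·-identityˡ⃗ : ∀ s → pt e · s ≼ s
  ·-identityˡ⃗ s {c} p = e , c , lift refl , p , lift (reflexive (⊗-identityˡ c))

  ·-identityˡ⃖ : ∀ s → s ≼ pt e · s
  ·-identityˡ⃖ s (u , v , lift e≤u , p , lift uv≤c) = ⟦⟧-up s (begin
    v       ≈⟨ Eq.sym (⊗-identityˡ v) ⟩
    e ⊗ v   ≤⟨ ⊗-monoˡ v e≤u ⟩
    u ⊗ v   ≤⟨ uv≤c ⟩
    _       ∎) p

  ·-identityʳ⃗ : ∀ s → s · pt e ≼ s
  ·-identityʳ⃗ s {c} p = c , e , p , lift refl , lift (reflexive (⊗-identityʳ c))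

  ·-identityʳ⃖ : ∀ s → s ≼ s · pt e
  ·-identityʳ⃖ s (u , v , p , lift e≤v , lift uv≤c) = ⟦⟧-up s (begin
    u       ≈⟨ Eq.sym (⊗-identityʳ u) ⟩
    u ⊗ e   ≤⟨ ⊗-monoʳ u e≤v ⟩
    u ⊗ v   ≤⟨ uv≤c ⟩
    _       ∎) p

  ◇-ε : ◇ (pt e) ≼ pt e
  ◇-ε (lift e≤c) = lift (trans (⟶-refl e) (⟶-monoʳ e e≤c))

  ◇-· : ∀ s t → ◇ (s · t) ≼ ◇ s · ◇ t
  ◇-· s t (u , v , p , q , lift uv≤c) =
    □ u , □ v , p , q , lift (trans (□-⊗ u v) (⟶-monoʳ e uv≤c))

  termMonoid : OplaxPreorderedMonoid L
  termMonoid = record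
    { Carrier = Term ; _≼_ = _≼_
    ; ≼-refl = λ p → p ; ≼-trans = λ t≼s s≼r p → t≼s (s≼r p)
    ; _·_ = _·_ ; ε = pt e ; ·-mono = λ {s s′ t t′} → ·-mono {s} {s′} {t} {t′}
    ; ·-assoc⃗ = ·-assoc⃗ ; ·-assoc⃖ = ·-assoc⃖
    ; ·-identityˡ⃗ = ·-identityˡ⃗ ; ·-identityˡ⃖ = ·-identityˡ⃖
    ; ·-identityʳ⃗ = ·-identityʳ⃗ ; ·-identityʳ⃖ = ·-identityʳ⃖
    ; d = ◇ ; d-mono = λ s≼t p → s≼t p ; d-ε = ◇-ε ; d-· = ◇-·
    }

  ≼-pt : ∀ {t x} → (t ≼ pt x) ⇔ ⟦ t ⟧ x
  ≼-pt {t} = mk⇔ (λ h → h (lift refl)) (λ p {_} (lift x≤c) → ⟦⟧-up t x≤c p)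

  pt-⊗ : ∀ x y → (pt (x ⊗ y) ≼ pt x · pt y) × (pt x · pt y ≼ pt (x ⊗ y))
  pt-⊗ x y =
    (λ { (u , v , lift x≤u , lift y≤v , lift uv≤c) →
           lift (trans (trans (⊗-monoˡ y x≤u) (⊗-monoʳ u y≤v)) uv≤c) })
    , λ { (lift xy≤c) → x , y , lift refl , lift refl , lift xy≤c }

  pt-order : ∀ x y → (pt x ≼ pt y) ⇔ (x ≤ y)
  pt-order x y = mk⇔ lower lift ⇔-∘ ≼-pt {pt x} {y}

  ⟦⟧-⟶ : ∀ x y s → ⟦ pt x · ◇ s ⟧ y ⇔ ⟦ s ⟧ (x ⟶ y)
  ⟦⟧-⟶ x y s = mk⇔
    (λ { (u , v , lift x≤u , p , lift uv≤y) →
           let v≤x⇒y = Equivalence.to (residual x v y) (trans (⊗-monoˡ v x≤u) uv≤y)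
           in ⟦⟧-up s (trans (⟶-monoʳ e v≤x⇒y) (□⇒≤⟶ x y)) p })
    (λ p → x , x ⇒ y , lift refl , ⟦⟧-up s (⟶≤□⇒ x y) p , lift (eval x y))

  pt-⟶ : ∀ x y s → (pt x · ◇ s ≼ pt y) ⇔ (s ≼ pt (x ⟶ y))
  pt-⟶ x y s = ⇔-sym (≼-pt {s} {x ⟶ y}) ⇔-∘ (⟦⟧-⟶ x y s ⇔-∘ ≼-pt {pt x · ◇ s} {y})

theorem6p2 : ∀ {a ℓ₁ ℓ₂} (A : StrongAlgebra a ℓ₁ ℓ₂)
    (_⇒_ : StrongAlgebra.Carrier A → StrongAlgebra.Carrier A → StrongAlgebra.Carrier A) →
    IsLeftResidual A _⇒_ →
    Internalizes A _⇒_ →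
    Σ (Spacetime (lsuc (a ⊔ ℓ₁ ⊔ ℓ₂)) (a ⊔ ℓ₁ ⊔ ℓ₂) (a ⊔ ℓ₁ ⊔ ℓ₂) (a ⊔ ℓ₁ ⊔ ℓ₂)) λ S →
    Σ (StrongAlgebra.Carrier A → Spacetime.Carrier S) λ i →
    IsStrongEmbedding A S i
theorem6p2 A _⇒_ residual internal =
  spacetime , (λ x → ↓ pt x) ,
  principal-embedding A pt
    ((λ p → p) , (λ p → p)) pt-⊗ pt-order pt-⟶
  where
  open TermModel A _⇒_ residual internal
  open Downsets termMonoid
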